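{- Let $G$ be a graph with vertex set $\{v_1,\dots,v_k\}$, let $M_i=(V_i,E_i)$, $1\le i\le k$, be pairwise vertex-disjoint graphs, and let $H$ be the graph obtained from $G$ by expanding each $v_i$ by the module $M_i$. Then the number of minimal separators of $H$ is at most the number of minimal separators of $G$ plus the sum over $i=1,\dots,k$ of the number of minimal separators of $M_i$.
   Context: The expansion $H$ has vertex set $V_1\cup\dots\cup V_k$ and edge set $E_1\cup\dots\cup E_k\cup\{ab\mid a\in V_i,\ b\in V_j,\ v_iv_j\in E(G)\}$. A minimal separator of a graph is a vertex set that is an inclusion-minimal $u,v$-separator for some pair of vertices $u,v$, where a $u,v$-separator is a set whose removal puts $u$ and $v$ into different connected components. -}

module Defs where

open import Data.Nat using (ℕ; _+_; _≤_)
open import Data.Nat.ListAction using (sum)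
open import Data.Fin using (Fin)
open import Data.Bool using (Bool; true; false)
open import Data.List using (tabulate)
open import Data.Product using (Σ; _,_; _×_; ∃)
open import Data.Sum using (_⊎_)
open import Relation.Nullary using (¬_)
open import Relation.Binary.PropositionalEquality using (_≡_)

record Graph (V : Set) : Set₁ where
  field
    Adj     : V → V → Set
    sym     : ∀ {x y} → Adj x y → Adj y x
    irrefl  : ∀ {x} → ¬ Adj x x
open Graph public

VSet : Set → Set
VSet V = V → Bool

_∈ₛ_ : {V : Set} → V → VSet V → Set
x ∈ₛ S = S x ≡ true

_∉ₛ_ : {V : Set} → V → VSet V → Set
x ∉ₛ S = S x ≡ false

_⊆ₛ_ : {V : Set} → VSet V → VSet V → Set
S ⊆ₛ T = ∀ x → x ∈ₛ S → x ∈ₛ T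

_≐_ : {V : Set} → VSet V → VSet V → Set
S ≐ T = ∀ x → S x ≡ T x

data Conn {V : Set} (G : Graph V) (S : VSet V) : V → V → Set where
  here : ∀ {u} → u ∉ₛ S → Conn G S u u
  step : ∀ {u w v} → u ∉ₛ S → Adj G u w → Conn G S w v → Conn G S u v

IsSeparator : {V : Set} → Graph V → VSet V → V → V → Set
IsSeparator G S u v = u ∉ₛ S × v ∉ₛ S × ¬ Conn G S u v

IsMinimalSeparatorFor : {V : Set} → Graph V → VSet V → V → V → Set
IsMinimalSeparatorFor G S u v =
  IsSeparator G S u v × (∀ T → T ⊆ₛ S → IsSeparator G T u v → S ⊆ₛ T)

IsMinimalSeparator : {V : Set} → Graph V → VSet V → Set
IsMinimalSeparator G S = Σ _ λ u → Σ _ λ v → IsMinimalSeparatorFor G S u v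

HasCount : {V : Set} → (VSet V → Set) → ℕ → Set
HasCount {V} P c =
  Σ (Fin c → VSet V) λ f →
    (∀ i j → f i ≐ f j → i ≡ j) ×
    (∀ i → P (f i)) ×
    (∀ S → P S → ∃ λ i → f i ≐ S)

NumMinSeps : {V : Set} → Graph V → ℕ → Set
NumMinSeps G c = HasCount (IsMinimalSeparator G) c

data ExpAdj {k : ℕ} (G : Graph (Fin k)) (n : Fin k → ℕ)
            (M : (i : Fin k) → Graph (Fin (n i))) :
            Σ (Fin k) (λ i → Fin (n i)) → Σ (Fin k) (λ i → Fin (n i)) → Set where
  inner : ∀ {i a b} → Adj (M i) a b → ExpAdj G n M (i , a) (i , b)
  outer : ∀ {i j a b} → Adj G i j → ExpAdj G n M (i , a) (j , b)

expAdj-sym : ∀ {k} {G : Graph (Fin k)} {n} {M : (i : Fin k) → Graph (Fin (n i))} {x y} →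
             ExpAdj G n M x y → ExpAdj G n M y x
expAdj-sym {M = M} (inner {i} p) = inner (sym (M i) p)
expAdj-sym {G = G} (outer p) = outer (sym G p)

expAdj-irrefl : ∀ {k} {G : Graph (Fin k)} {n} {M : (i : Fin k) → Graph (Fin (n i))} {x} →
                ¬ ExpAdj G n M x x
expAdj-irrefl {M = M} (inner {i} p) = irrefl (M i) p
expAdj-irrefl {G = G} (outer p) = irrefl G p

expand : {k : ℕ} (G : Graph (Fin k)) (n : Fin k → ℕ)
         (M : (i : Fin k) → Graph (Fin (n i))) → Graph (Σ (Fin k) (λ i → Fin (n i)))
expand G n M = record
  { Adj = ExpAdj G n M
  ; sym = expAdj-sym
  ; irrefl = expAdj-irrefl }

-- A minimal separator S of H separating two vertices of the same module M i
-- contains every module adjacent to v_i, and minimality forces S to consist of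
-- exactly these modules together with a minimal separator of M i; so S is
-- determined by i and that separator of M i. If S separates vertices of
-- different modules V_i, V_j, the modules lying entirely in S form a
-- v_i,v_j-separator of G, hence contain a minimal one T, and minimality forces
-- S to be the union of the modules of T; so S is determined by T. This injects
-- the minimal separators of H into the disjoint union of those of G and the M i.
module Submission where

open import Defs
open import Data.Nat using (ℕ; _+_; _≤_)
import Data.Nat as ℕ
open import Data.Nat.ListAction using (sum)
open import Data.Fin using (Fin)
open import Data.List using (tabulate)

open import Data.Bool using (true; false; _∧_)
import Data.Bool as Bool
open import Data.Bool.Properties using (¬-not; T-≡; T-not-≡)
open import Data.Empty using (⊥-elim)
open import Data.Fin using (zero; suc; _↑ˡ_; _↑ʳ_; splitAt)
open import Data.Fin.Properties
  using (_≟_; all?; ¬∀⟶∃¬; injective⇒≤; splitAt-↑ˡ; splitAt-↑ʳ; sequence)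
import Data.Fin.Subset as Subset
open import Data.Fin.Subset.Induction using (⊂-wellFounded)
open import Data.Nat.Properties using (_≤?_)
open import Data.Product using (Σ; ∃; ∃₂; _,_; _×_; proj₁; proj₂; map)
open import Data.Sum using ([_,_]′)
import Data.Vec as Vec
open import Data.Vec.Functional using (_∷_)
open import Data.Vec.Properties using (lookup∘tabulate; lookup⇒[]=; []=⇒lookup)
open import Effect.Monad using (RawMonad)
open import Function using (_∘_; id)
open import Function.Bundles using (module Equivalence)
open import Function.Definitions using (Injective)
open import Induction.WellFounded
  using (WellFounded; Acc; acc; module Subrelation)
import Relation.Binary.Construct.On as On
open import Relation.Nullary using (¬_; yes; no; contradiction; ¬¬-map)
open import Relation.Nullary.Decidable
  using (isYes; toWitness; toWitnessFalse; fromWitnessFalse; decidable-stable)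
open import Relation.Nullary.Negation using (¬¬-Monad)
open import Relation.Binary.PropositionalEquality as ≡
  using (_≡_; refl; trans; cong; cong₂; subst)

private variable
  V : Set
  m : ℕ

∈⇒¬∉ : {S : VSet V} {x : V} → x ∈ₛ S → ¬ x ∉ₛ S
∈⇒¬∉ x∈S x∉S = contradiction (trans (≡.sym x∈S) x∉S) λ ()

⊆-refl : {S : VSet V} → S ⊆ₛ S
⊆-refl _ x∈S = x∈S

⊆-trans : {S T U : VSet V} → S ⊆ₛ T → T ⊆ₛ U → S ⊆ₛ U
⊆-trans S⊆T T⊆U x = T⊆U x ∘ S⊆T x

⊆-antisym : {S T : VSet V} → S ⊆ₛ T → T ⊆ₛ S → S ≐ T
⊆-antisym {S = S} {T} S⊆T T⊆S x with S x in Sx | T x in Tx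
... | true  | true  = refl
... | false | false = refl
... | true  | false = ⊥-elim (∈⇒¬∉ {S = T} (S⊆T x Sx) Tx)
... | false | true  = ⊥-elim (∈⇒¬∉ {S = S} (T⊆S x Tx) Sx)

_∩ₛ_ : VSet V → VSet V → VSet V
(S ∩ₛ T) x = S x ∧ T x

∩-⊆ˡ : {S T : VSet V} → (S ∩ₛ T) ⊆ₛ S
∩-⊆ˡ {S = S} x _ with S x
... | true = refl

∩-⊆ʳ : {S T : VSet V} → (S ∩ₛ T) ⊆ₛ T
∩-⊆ʳ {S = S} x x∈S∩T with S x
... | true = x∈S∩T

∩-∈ : {S T : VSet V} {x : V} → x ∈ₛ S → x ∈ₛ T → x ∈ₛ (S ∩ₛ T)
∩-∈ x∈S x∈T = cong₂ _∧_ x∈S x∈T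

_⊂ₛ_ : VSet V → VSet V → Set
T ⊂ₛ S = T ⊆ₛ S × ∃ λ x → x ∈ₛ S × x ∉ₛ T

∈ₛ⇒∈-tabulate : {S : VSet (Fin m)} {x : Fin m} → x ∈ₛ S → x Subset.∈ Vec.tabulate S
∈ₛ⇒∈-tabulate {S = S} {x} x∈S = lookup⇒[]= x (Vec.tabulate S) (trans (lookup∘tabulate S x) x∈S)

∈-tabulate⇒∈ₛ : {S : VSet (Fin m)} {x : Fin m} → x Subset.∈ Vec.tabulate S → x ∈ₛ S
∈-tabulate⇒∈ₛ {S = S} {x} x∈S = trans (≡.sym (lookup∘tabulate S x)) ([]=⇒lookup x∈S)

⊂ₛ⇒⊂-tabulate : {S T : VSet (Fin m)} → T ⊂ₛ S → Vec.tabulate T Subset.⊂ Vec.tabulate S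
⊂ₛ⇒⊂-tabulate {T = T} (T⊆S , x , x∈S , x∉T) =
  (λ {y} → ∈ₛ⇒∈-tabulate ∘ T⊆S y ∘ ∈-tabulate⇒∈ₛ) ,
  x , ∈ₛ⇒∈-tabulate x∈S , λ x∈T → ∈⇒¬∉ {S = T} (∈-tabulate⇒∈ₛ x∈T) x∉T

⊂ₛ-wellFounded : WellFounded (_⊂ₛ_ {Fin m})
⊂ₛ-wellFounded =
  Subrelation.wellFounded ⊂ₛ⇒⊂-tabulate (On.wellFounded Vec.tabulate ⊂-wellFounded)

Minimal : (VSet V → Set) → VSet V → Set
Minimal P S = P S × (∀ T → T ⊆ₛ S → P T → S ⊆ₛ T)

-- R is itself minimal unless some P-set is strictly below it, in which case recurse there.
minimal-⊆-acc : (P : VSet V → Set) {R : VSet V} → Acc _⊂ₛ_ R → P R →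
                ¬ ¬ (∃ λ T → T ⊆ₛ R × Minimal P T)
minimal-⊆-acc P {R} (acc below) pR ¬minimal = ¬minimal (R , ⊆-refl , pR , R-minimal)
  where
  R-minimal : ∀ T → T ⊆ₛ R → P T → R ⊆ₛ T
  R-minimal T T⊆R pT x x∈R with T x in Tx
  ... | true  = refl
  ... | false = ⊥-elim (minimal-⊆-acc P (below (T⊆R , x , x∈R , Tx)) pT
                  λ (U , U⊆T , minimalU) → ¬minimal (U , ⊆-trans U⊆T T⊆R , minimalU))

minimal-⊆ : (P : VSet (Fin m) → Set) {R : VSet (Fin m)} → P R →
            ¬ ¬ (∃ λ T → T ⊆ₛ R × Minimal P T)
minimal-⊆ P {R} = minimal-⊆-acc P (⊂ₛ-wellFounded R)

Conn-source∉ : {G : Graph V} {S : VSet V} {u v : V} → Conn G S u v → u ∉ₛ S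
Conn-source∉ (here u∉S)     = u∉S
Conn-source∉ (step u∉S _ _) = u∉S

Conn-resp-≐ : {G : Graph V} {S T : VSet V} {u v : V} → S ≐ T → Conn G S u v → Conn G T u v
Conn-resp-≐ S≐T (here u∉S)       = here (trans (≡.sym (S≐T _)) u∉S)
Conn-resp-≐ S≐T (step u∉S uw wv) = step (trans (≡.sym (S≐T _)) u∉S) uw (Conn-resp-≐ S≐T wv)

IsSeparator-resp-≐ : {G : Graph V} {S T : VSet V} {u v : V} →
                     S ≐ T → IsSeparator G S u v → IsSeparator G T u v
IsSeparator-resp-≐ {u = u} {v} S≐T (u∉S , v∉S , ¬uv) =
  trans (≡.sym (S≐T u)) u∉S , trans (≡.sym (S≐T v)) v∉S , ¬uv ∘ Conn-resp-≐ (≡.sym ∘ S≐T)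

enumerate : {P : VSet V → Set} {c : ℕ} → HasCount P c → Fin c → VSet V
enumerate = proj₁

enumerate-covers : {P : VSet V → Set} {c : ℕ} (h : HasCount P c) {S : VSet V} →
                   P S → ∃ λ i → enumerate h i ≐ S
enumerate-covers (_ , _ , _ , covers) = covers _

HasCount-≤ : {P : VSet V → Set} {A : Set} {c N : ℕ} (encode : A → Fin N) →
             Injective _≡_ _≡_ encode → (Encodes : VSet V → A → Set) →
             (∀ {S S′ x} → Encodes S x → Encodes S′ x → S ≐ S′) →
             (∀ {S} → P S → ¬ ¬ ∃ (Encodes S)) →
             HasCount P c → ¬ ¬ (c ≤ N)
HasCount-≤ encode encode-injective Encodes unique encodable (f , f-injective , f-P , _) =
  ¬¬-map (λ code → injective⇒≤ (code-injective code))
         (sequence (RawMonad.rawApplicative ¬¬-Monad) (encodable ∘ f-P))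
  where
  code-injective : (code : ∀ i → ∃ (Encodes (f i))) → Injective _≡_ _≡_ (encode ∘ proj₁ ∘ code)
  code-injective code {i} {j} eq = f-injective i j (unique (proj₂ (code i))
    (subst (Encodes (f j)) (≡.sym (encode-injective eq)) (proj₂ (code j))))

toFin-Σ : {k : ℕ} (c : Fin k → ℕ) → Σ (Fin k) (Fin ∘ c) → Fin (sum (tabulate c))
toFin-Σ c (zero  , x) = x ↑ˡ _
toFin-Σ c (suc i , x) = c zero ↑ʳ toFin-Σ (c ∘ suc) (i , x)

fromFin-Σ : {k : ℕ} (c : Fin k → ℕ) → Fin (sum (tabulate c)) → Σ (Fin k) (Fin ∘ c)
fromFin-Σ {ℕ.suc k} c y = [ (zero ,_) , map suc id ∘ fromFin-Σ (c ∘ suc) ]′ (splitAt (c zero) y)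

fromFin-toFin-Σ : {k : ℕ} (c : Fin k → ℕ) (p : Σ (Fin k) (Fin ∘ c)) →
                  fromFin-Σ c (toFin-Σ c p) ≡ p
fromFin-toFin-Σ c (zero , x) =
  cong [ (zero ,_) , map suc id ∘ fromFin-Σ (c ∘ suc) ]′ (splitAt-↑ˡ (c zero) x _)
fromFin-toFin-Σ c (suc i , x)
  rewrite splitAt-↑ʳ (c zero) (sum (tabulate (c ∘ suc))) (toFin-Σ (c ∘ suc) (i , x)) =
  cong (map suc id) (fromFin-toFin-Σ (c ∘ suc) (i , x))

toFin-Σ-injective : {k : ℕ} (c : Fin k → ℕ) → Injective _≡_ _≡_ (toFin-Σ c)
toFin-Σ-injective c {p} {q} eq = begin
  p                          ≡⟨ ≡.sym (fromFin-toFin-Σ c p) ⟩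
  fromFin-Σ c (toFin-Σ c p)  ≡⟨ cong (fromFin-Σ c) eq ⟩
  fromFin-Σ c (toFin-Σ c q)  ≡⟨ fromFin-toFin-Σ c q ⟩
  q                          ∎
  where open ≡.≡-Reasoning

module Expansion {k : ℕ} (G : Graph (Fin k)) (n : Fin k → ℕ)
                 (M : (i : Fin k) → Graph (Fin (n i))) where

  X : Set
  X = Σ (Fin k) (λ i → Fin (n i))

  H : Graph X
  H = expand G n M

  infix 25 _↾_

  _↾_ : VSet X → (i : Fin k) → VSet (Fin (n i))
  (S ↾ i) a = S (i , a)

  blowUp : VSet (Fin k) → VSet X
  blowUp T = T ∘ proj₁

  fullModules : VSet X → VSet (Fin k)
  fullModules S l = isYes (all? λ c → S (l , c) Bool.≟ true)

  _[_≔_] : VSet X → (i : Fin k) → VSet (Fin (n i)) → VSet X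
  _[_≔_] S i T (l , c) with l ≟ i
  ... | yes refl = T c
  ... | no _     = S (l , c)

  CoversNeighbours : Fin k → VSet X → Set
  CoversNeighbours i S = ∀ {l} c → Adj G i l → (l , c) ∈ₛ S

  InnerMinimalSeparator : Fin k → VSet X → Set
  InnerMinimalSeparator i S = ∃₂ λ a b → IsMinimalSeparatorFor H S (i , a) (i , b)

  fullModules-⊆ : ∀ {S l} → l ∈ₛ fullModules S → ∀ c → (l , c) ∈ₛ S
  fullModules-⊆ l∈ = toWitness (Equivalence.from T-≡ l∈)

  ∉fullModules : ∀ {S l} → l ∉ₛ fullModules S → ∃ λ c → (l , c) ∉ₛ S
  ∉fullModules {S} {l} l∉ with ¬∀⟶∃¬ _ _ (λ c → S (l , c) Bool.≟ true)
                                 (toWitnessFalse (Equivalence.from T-not-≡ l∉))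
  ... | c , c∉ = c , ¬-not c∉

  ∉⇒∉fullModules : ∀ {S l c} → (l , c) ∉ₛ S → l ∉ₛ fullModules S
  ∉⇒∉fullModules {S} c∉ =
    Equivalence.to T-not-≡ (fromWitnessFalse λ full → ∈⇒¬∉ {S = S} (full _) c∉)

  [≔]-↾ : ∀ {S i T} → (S [ i ≔ T ]) ↾ i ≐ T
  [≔]-↾ {i = i} c with i ≟ i
  ... | yes refl = refl
  ... | no i≢i   = contradiction refl i≢i

  [≔]-≢ : ∀ {S i T l c} → ¬ l ≡ i → (S [ i ≔ T ]) (l , c) ≡ S (l , c)
  [≔]-≢ {i = i} {l = l} l≢i with l ≟ i
  ... | yes l≡i = contradiction l≡i l≢i
  ... | no _    = refl

  [≔]-⊆ : ∀ {S R i T} → T ⊆ₛ (R ↾ i) → S ⊆ₛ R → (S [ i ≔ T ]) ⊆ₛ R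
  [≔]-⊆ {i = i} T⊆R S⊆R (l , c) c∈ with l ≟ i
  ... | yes refl = T⊆R c c∈
  ... | no _     = S⊆R (l , c) c∈

  [≔]-covers : ∀ {S i T} → CoversNeighbours i S → CoversNeighbours i (S [ i ≔ T ])
  [≔]-covers {S} {i} {T} cov c il =
    trans ([≔]-≢ {S} {i} {T} λ { refl → irrefl G il }) (cov c il)

  Conn-inner : ∀ {S i a b} → Conn (M i) (S ↾ i) a b → Conn H S (i , a) (i , b)
  Conn-inner (here a∉)       = here a∉
  Conn-inner (step a∉ ab bc) = step a∉ (inner ab) (Conn-inner bc)

  Conn-within : ∀ {S i a b} → CoversNeighbours i S →
                Conn H S (i , a) (i , b) → Conn (M i) (S ↾ i) a b
  Conn-within cov (here a∉)               = here a∉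
  Conn-within cov (step a∉ (inner ab) bc) = step a∉ ab (Conn-within cov bc)
  Conn-within {S} cov (step _ (outer il) lc) =
    ⊥-elim (∈⇒¬∉ {S = S} (cov _ il) (Conn-source∉ lc))

  Conn-project : ∀ {T x y} → Conn H (blowUp T) x y → Conn G T (proj₁ x) (proj₁ y)
  Conn-project (here x∉)               = here x∉
  Conn-project (step _ (inner _) yz)   = Conn-project yz
  Conn-project (step x∉ (outer xy) yz) = step x∉ xy (Conn-project yz)

  -- The edge into l is needed because two vertices of the same module need not be joined inside it.
  Conn-lift : ∀ {S p l j c b} → (p , c) ∉ₛ S → Adj G p l →
              Conn G (fullModules S) l j → (j , b) ∉ₛ S → Conn H S (p , c) (j , b)
  Conn-lift c∉ pl (here _) b∉ = step c∉ (outer pl) (here b∉)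
  Conn-lift {S} c∉ pl (step l∉ lm mj) b∉ with ∉fullModules {S} l∉
  ... | c′ , c′∉ = step c∉ (outer pl) (Conn-lift {S} c′∉ lm mj b∉)

  separator-covers : ∀ {S i a b} → IsSeparator H S (i , a) (i , b) → CoversNeighbours i S
  separator-covers {S} (a∉ , b∉ , ¬ab) {l} c il with S (l , c) in c∉
  ... | true  = refl
  ... | false = ⊥-elim (¬ab (step a∉ (outer il) (step c∉ (outer (sym G il)) (here b∉))))

  separator-↾ : ∀ {S i a b} → IsSeparator H S (i , a) (i , b) → IsSeparator (M i) (S ↾ i) a b
  separator-↾ (a∉ , b∉ , ¬ab) = a∉ , b∉ , ¬ab ∘ Conn-inner

  covers-separator : ∀ {S i a b} → CoversNeighbours i S →
                     IsSeparator (M i) (S ↾ i) a b → IsSeparator H S (i , a) (i , b)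
  covers-separator cov (a∉ , b∉ , ¬ab) = a∉ , b∉ , ¬ab ∘ Conn-within cov

  fullModules-separator : ∀ {S i j a b} → ¬ i ≡ j →
                          IsSeparator H S (i , a) (j , b) → IsSeparator G (fullModules S) i j
  fullModules-separator {S} i≢j (a∉ , b∉ , ¬ab) =
    ∉⇒∉fullModules {S} a∉ , ∉⇒∉fullModules {S} b∉ ,
    λ { (here _) → i≢j refl ; (step _ il lj) → ¬ab (Conn-lift a∉ il lj b∉) }

  blowUp-separator : ∀ {T i j a b} → IsSeparator G T i j → IsSeparator H (blowUp T) (i , a) (j , b)
  blowUp-separator (i∉ , j∉ , ¬ij) = i∉ , j∉ , ¬ij ∘ Conn-project

  minimalSeparator-↾ : ∀ {S i a b} → IsMinimalSeparatorFor H S (i , a) (i , b) →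
                       IsMinimalSeparatorFor (M i) (S ↾ i) a b
  minimalSeparator-↾ {S} {i} (sep , minimal) = separator-↾ sep , ↾-minimal
    where
    ↾-minimal : ∀ T → T ⊆ₛ (S ↾ i) → IsSeparator (M i) T _ _ → (S ↾ i) ⊆ₛ T
    ↾-minimal T T⊆ sepT c c∈ = trans (≡.sym ([≔]-↾ {S} c))
      (minimal (S [ i ≔ T ]) ([≔]-⊆ T⊆ ⊆-refl)
        (covers-separator ([≔]-covers {S} (separator-covers sep))
          (IsSeparator-resp-≐ (≡.sym ∘ [≔]-↾ {S}) sepT))
        (i , c) c∈)

  -- Shrinking S to S ∩ B outside module i keeps it a separator, so minimality forbids any loss.
  minimalSeparator-outside-⊆ : ∀ {S B i a b} → IsMinimalSeparatorFor H S (i , a) (i , b) →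
                               CoversNeighbours i B → ∀ {l} c → ¬ l ≡ i → (l , c) ∈ₛ S → (l , c) ∈ₛ B
  minimalSeparator-outside-⊆ {S} {B} {i} (sep , minimal) covB c l≢i c∈S =
    ∩-⊆ʳ {S = S} {B} _ (trans (≡.sym ([≔]-≢ {S ∩ₛ B} l≢i)) (minimal S′ S′⊆S S′-separator _ c∈S))
    where
    S′ : VSet X
    S′ = (S ∩ₛ B) [ i ≔ S ↾ i ]
    S′⊆S : S′ ⊆ₛ S
    S′⊆S = [≔]-⊆ ⊆-refl (∩-⊆ˡ {S = S})
    S′-separator : IsSeparator H S′ _ _
    S′-separator = covers-separator
      ([≔]-covers {S ∩ₛ B} λ c il → ∩-∈ {S = S} {B} (separator-covers sep c il) (covB c il))
      (IsSeparator-resp-≐ (≡.sym ∘ [≔]-↾ {S ∩ₛ B}) (separator-↾ sep))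

  innerMinimalSeparator-⊆ : ∀ {S S′ i} → InnerMinimalSeparator i S → InnerMinimalSeparator i S′ →
                            S ↾ i ≐ S′ ↾ i → S ⊆ₛ S′
  innerMinimalSeparator-⊆ {i = i} (_ , _ , minimal) (_ , _ , minimal′) S≐S′ (l , c) c∈ with l ≟ i
  ... | yes refl = trans (≡.sym (S≐S′ c)) c∈
  ... | no l≢i   = minimalSeparator-outside-⊆ minimal (separator-covers (proj₁ minimal′)) c l≢i c∈

  innerMinimalSeparator-≐ : ∀ {S S′ i} → InnerMinimalSeparator i S → InnerMinimalSeparator i S′ →
                            S ↾ i ≐ S′ ↾ i → S ≐ S′
  innerMinimalSeparator-≐ S-inner S′-inner S≐S′ = ⊆-antisym
    (innerMinimalSeparator-⊆ S-inner S′-inner S≐S′)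
    (innerMinimalSeparator-⊆ S′-inner S-inner (≡.sym ∘ S≐S′))

  minimalSeparator-≐-blowUp : ∀ {S T i j a b} → IsMinimalSeparatorFor H S (i , a) (j , b) →
                              T ⊆ₛ fullModules S → IsSeparator G T i j → S ≐ blowUp T
  minimalSeparator-≐-blowUp {S} {T} (_ , minimal) T⊆ sepT =
    ⊆-antisym (minimal (blowUp T) blowUp⊆S (blowUp-separator sepT)) blowUp⊆S
    where
    blowUp⊆S : blowUp T ⊆ₛ S
    blowUp⊆S (l , c) l∈ = fullModules-⊆ {S} (T⊆ l l∈) c

  module Encoding {cG : ℕ} {cM : Fin k → ℕ}
                  (hG : NumMinSeps G cG) (hM : ∀ i → NumMinSeps (M i) (cM i)) where

    -- Index zero stands for G and suc i for M i, so that Code has cG + sum (tabulate cM) elements.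
    Code : Set
    Code = Σ (Fin (ℕ.suc k)) (Fin ∘ (cG ∷ cM))

    Encodes : VSet X → Code → Set
    Encodes S (zero  , g) = S ≐ blowUp (enumerate hG g)
    Encodes S (suc i , m) = InnerMinimalSeparator i S × S ↾ i ≐ enumerate (hM i) m

    Encodes-unique : ∀ {S S′ x} → Encodes S x → Encodes S′ x → S ≐ S′
    Encodes-unique {x = zero  , _} S≐ S′≐ v = trans (S≐ v) (≡.sym (S′≐ v))
    Encodes-unique {x = suc _ , _} (S-inner , S≐) (S′-inner , S′≐) =
      innerMinimalSeparator-≐ S-inner S′-inner λ c → trans (S≐ c) (≡.sym (S′≐ c))

    encodable : ∀ {S} → IsMinimalSeparator H S → ¬ ¬ ∃ (Encodes S)
    encodable {S} ((i , a) , (j , b) , minimal) with i ≟ j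
    ... | yes refl with enumerate-covers (hM i) (a , b , minimalSeparator-↾ minimal)
    ...   | m , m≐ = contradiction ((suc i , m) , (a , b , minimal) , ≡.sym ∘ m≐)
    encodable {S} ((i , a) , (j , b) , minimal) | no i≢j =
      ¬¬-map encodeBy (minimal-⊆ (λ T → IsSeparator G T i j)
                        (fullModules-separator i≢j (proj₁ minimal)))
      where
      encodeBy : (∃ λ T → T ⊆ₛ fullModules S × IsMinimalSeparatorFor G T i j) → ∃ (Encodes S)
      encodeBy (T , T⊆ , minimalT) with enumerate-covers hG (i , j , minimalT)
      ... | g , g≐ = (zero , g) ,
        λ v → trans (minimalSeparator-≐-blowUp minimal T⊆ (proj₁ minimalT) v) (≡.sym (g≐ (proj₁ v)))

corollary2 : (k : ℕ) (G : Graph (Fin k)) (n : Fin k → ℕ)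
    (M : (i : Fin k) → Graph (Fin (n i)))
    (cG : ℕ) (cM : Fin k → ℕ) (cH : ℕ) →
    NumMinSeps G cG →
    (∀ i → NumMinSeps (M i) (cM i)) →
    NumMinSeps (expand G n M) cH →
    cH ≤ cG + sum (tabulate cM)
corollary2 k G n M cG cM cH hG hM hH =
  decidable-stable (cH ≤? cG + sum (tabulate cM))
    (HasCount-≤ (toFin-Σ (cG ∷ cM)) (toFin-Σ-injective (cG ∷ cM))
                Encodes Encodes-unique encodable hH)
  where open Expansion G n M; open Encoding hG hM
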